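{- Let $n,k$ be positive integers, $N=n+k$, let $U$ be a unit interval order with $N$ elements, and let $w=[w_1,\dots,w_N]\in P^U_N$, with indices understood modulo $N$. Suppose that for some index $m$ we have $w_{m+k}\succ w_{m+1}$ and $w_m\rightarrow w_{m+k+1}$. Then the three sequences $$[w_{m+k},w_{m+k+1},\dots,w_{m+k+n-1}],\quad [w_{m+k+1},w_{m+k+2},\dots,w_{m+k+n}],\quad [w_{m+k+2},w_{m+k+3},\dots,w_{m+k+n+1}]$$ are all $n$-Eschers in $U$.
   Context: A unit interval order (UIO) $U$ is a finite subset of $\mathbb{R}$. For $a,b\in U$: $a\prec b$ (equivalently $b\succ a$) means $b\ge a+1$; $a\rightarrow b$ means $b>a-1$ (i.e. $a\succ b$ fails). A sequence $[w_1,\dots,w_m]$ of pairwise distinct elements of $U$ is an $m$-Escher if $w_1\rightarrow w_2\rightarrow\cdots\rightarrow w_m\rightarrow w_1$. $P^U_m$ denotes the set of $m$-Eschers in $U$.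
   Formalization: The unit interval order U is a finite set of rationals instead of a finite subset of ℝ, so the entries of w are rational as well. -}

module Defs where

open import Data.Nat using (ℕ; zero; suc)
open import Data.Nat.DivMod using (_mod_)
open import Data.Fin using (Fin; toℕ)
open import Data.Rational using (ℚ; _+_; _≤_; 1ℚ; 0ℚ)
open import Data.List using (List)
open import Data.List.Membership.Propositional using (_∈_)
open import Data.Product using (_×_)
open import Data.Sum using (_⊎_)
open import Relation.Binary.PropositionalEquality using (_≡_)
open import Relation.Nullary using (¬_)
open import Function.Definitions using (Injective)

-- Elements of a unit interval order are (rational) numbers.
-- a ≺ b  :  b ≥ a + 1
_≺_ : ℚ → ℚ → Set
a ≺ b = a + 1ℚ ≤ b

_⟶_ : ℚ → ℚ → Set
a ⟶ b = ¬ (b ≺ a)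

CycSucc : {m : ℕ} → Fin m → Fin m → Set
CycSucc {m} i j = (suc (toℕ i) ≡ toℕ j) ⊎ ((suc (toℕ i) ≡ m) × (toℕ j ≡ 0))

Escher : (U : List ℚ) (m : ℕ) → (Fin m → ℚ) → Set
Escher U m w =
  ((i : Fin m) → w i ∈ U) ×
  Injective _≡_ _≡_ w ×
  ((i j : Fin m) → CycSucc i j → w i ⟶ w j)

at : (N : ℕ) → (Fin N → ℚ) → ℕ → ℚ
at zero w j = 0ℚ
at (suc N) w j = w (j mod suc N)

{-# OPTIONS --safe #-}
-- Read w periodically as W j = w (j mod N), so that W j ⟶ W (suc j) for every j.
-- A window of p + 1 ≤ N consecutive entries of W inherits membership and
-- injectivity from w, hence is an Escher as soon as its last entry points back to
-- its first.  For the three windows these closing arrows are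
--   W (m+k+n-1) ⟶ W m ⟶ W (m+1) ≺ W (m+k),
--   W (m+k+n) = W m ⟶ W (m+k+1)  (the hypothesis),
--   W (m+k+n+1) = W (m+1) ≺ W (m+k) ⟶ W (m+k+1) ⟶ W (m+k+2),
-- and in a unit interval order both a ⟶ b ⟶ c ≺ d and a ≺ b ⟶ c ⟶ d imply a ⟶ d.
module Submission where

open import Defs
open import Data.Nat using (ℕ; _+_; _*_; _∸_; _≤_; _<_; suc; NonZero; _%_; _<?_)
open import Data.Nat.Properties
  using ( +-comm; +-assoc; +-suc; +-identityʳ; +-cancelˡ-≡; suc-injective
        ; ≤-total; ≤-antisym; ≮⇒≥; <-≤-trans; ≤-<-trans; m≤m+n; m∸n≤m; m+[n∸m]≡n)
open import Data.Nat.DivMod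
  using ( _/_; _mod_; m%n<n; m≡m%n+[m/n]*n; m%n%n≡m%n; %-distribˡ-+
        ; [m+n]%n≡m%n; m<n⇒m%n≡m; n%n≡0)
open import Data.Nat.Divisibility using (_∣_; ∣m+n∣m⇒∣n; n∣m*n; >⇒∤)
open import Data.Nat.Tactic.RingSolver using (solve)
open import Data.Fin using (Fin; toℕ)
open import Data.Fin.Properties using (toℕ-fromℕ<; toℕ-injective; toℕ<n)
open import Data.Rational as ℚ using (ℚ; 1ℚ)
import Data.Rational.Properties as ℚ
open import Data.List using (List; []; _∷_; length)
open import Data.List.Relation.Unary.Unique.Propositional using (Unique)
open import Data.Product using (_×_; _,_; proj₁; proj₂)
open import Data.Sum using (inj₁; inj₂; [_,_]′)
open import Relation.Nullary using (yes; no; contradiction)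
open import Relation.Binary.PropositionalEquality
  using (_≡_; refl; sym; trans; cong; subst; subst₂; module ≡-Reasoning)

-- a ⟶ b and a ≺ b unfold to inequalities between ℚ-sums, so Agda never infers
-- their endpoints; they are passed explicitly throughout.
⟶⇒< : ∀ {a b} → a ⟶ b → a ℚ.< b ℚ.+ 1ℚ
⟶⇒< = ℚ.≰⇒>

<⇒⟶ : ∀ {a b} → a ℚ.< b ℚ.+ 1ℚ → a ⟶ b
<⇒⟶ a<b+1 b+1≤a = ℚ.<-irrefl refl (ℚ.<-≤-trans a<b+1 b+1≤a)

⟶-⟶-≺⇒⟶ : ∀ {a b c d} → a ⟶ b → b ⟶ c → c ≺ d → a ⟶ d
⟶-⟶-≺⇒⟶ {a} {b} {c} {d} a⟶b b⟶c c≺d = <⇒⟶ {a} {d} (begin-strict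
  a                   <⟨ ⟶⇒< {a} {b} a⟶b ⟩
  b ℚ.+ 1ℚ            <⟨ ℚ.+-monoˡ-< 1ℚ {b} {c ℚ.+ 1ℚ} (⟶⇒< {b} {c} b⟶c) ⟩
  (c ℚ.+ 1ℚ) ℚ.+ 1ℚ   ≤⟨ ℚ.+-monoˡ-≤ 1ℚ {c ℚ.+ 1ℚ} {d} c≺d ⟩
  d ℚ.+ 1ℚ            ∎)
  where open ℚ.≤-Reasoning

≺-⟶-⟶⇒⟶ : ∀ {a b c d} → a ≺ b → b ⟶ c → c ⟶ d → a ⟶ d
≺-⟶-⟶⇒⟶ {a} {b} {c} {d} a≺b b⟶c c⟶d d+1≤a = ℚ.<-irrefl refl (begin-strict
  (d ℚ.+ 1ℚ) ℚ.+ 1ℚ   ≤⟨ ℚ.+-monoˡ-≤ 1ℚ {d ℚ.+ 1ℚ} {a} d+1≤a ⟩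
  a ℚ.+ 1ℚ            ≤⟨ a≺b ⟩
  b                   <⟨ ⟶⇒< {b} {c} b⟶c ⟩
  c ℚ.+ 1ℚ            <⟨ ℚ.+-monoˡ-< 1ℚ {c} {d ℚ.+ 1ℚ} (⟶⇒< {c} {d} c⟶d) ⟩
  (d ℚ.+ 1ℚ) ℚ.+ 1ℚ   ∎)
  where open ℚ.≤-Reasoning

module _ {n : ℕ} .{{_ : NonZero n}} where

  toℕ-mod : ∀ j → toℕ (j mod n) ≡ j % n
  toℕ-mod j = toℕ-fromℕ< (m%n<n j n)

  [o+m%n]%n≡[o+m]%n : ∀ o m → (o + m % n) % n ≡ (o + m) % n
  [o+m%n]%n≡[o+m]%n o m = begin
    (o + m % n) % n          ≡⟨ %-distribˡ-+ o (m % n) n ⟩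
    (o % n + m % n % n) % n  ≡⟨ cong (λ r → (o % n + r) % n) (m%n%n≡m%n m n) ⟩
    (o % n + m % n) % n      ≡⟨ sym (%-distribˡ-+ o m n) ⟩
    (o + m) % n              ∎
    where open ≡-Reasoning

  [m+o]%n≡m%n⇒n∣o : ∀ m o → (m + o) % n ≡ m % n → n ∣ o
  [m+o]%n≡m%n⇒n∣o m o eq =
    ∣m+n∣m⇒∣n (subst (n ∣_) quotients (n∣m*n ((m + o) / n))) (n∣m*n (m / n))
    where
    quotients : (m + o) / n * n ≡ m / n * n + o
    quotients = +-cancelˡ-≡ (m % n) _ _ (begin
      m % n + (m + o) / n * n         ≡⟨ cong (_+ (m + o) / n * n) (sym eq) ⟩
      (m + o) % n + (m + o) / n * n   ≡⟨ sym (m≡m%n+[m/n]*n (m + o) n) ⟩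
      m + o                           ≡⟨ cong (_+ o) (m≡m%n+[m/n]*n m n) ⟩
      m % n + m / n * n + o           ≡⟨ +-assoc (m % n) _ o ⟩
      m % n + (m / n * n + o)         ∎)
      where open ≡-Reasoning

  [m+o]%n≡m%n⇒o≡0 : ∀ m o → o < n → (m + o) % n ≡ m % n → o ≡ 0
  [m+o]%n≡m%n⇒o≡0 m 0       _   _  = refl
  [m+o]%n≡m%n⇒o≡0 m (suc o) o<n eq =
    contradiction ([m+o]%n≡m%n⇒n∣o m (suc o) eq) (>⇒∤ o<n)

  [m+i]%n-injective : ∀ m {i j} → i < n → j < n → (m + i) % n ≡ (m + j) % n → i ≡ j
  [m+i]%n-injective m {i} {j} i<n j<n eq =
    [ (λ i≤j → ordered i≤j j<n eq)
    , (λ j≤i → sym (ordered j≤i i<n (sym eq)))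
    ]′ (≤-total i j)
    where
    ordered : ∀ {i j} → i ≤ j → j < n → (m + i) % n ≡ (m + j) % n → i ≡ j
    ordered {i} {j} i≤j j<n eq = begin
      i               ≡⟨ sym (+-identityʳ i) ⟩
      i + 0           ≡⟨ cong (i +_) (sym gap≡0) ⟩
      i + (j ∸ i)     ≡⟨ m+[n∸m]≡n i≤j ⟩
      j               ∎
      where
      open ≡-Reasoning
      gap≡0 : j ∸ i ≡ 0
      gap≡0 = [m+o]%n≡m%n⇒o≡0 (m + i) (j ∸ i) (≤-<-trans (m∸n≤m j i) j<n)
        (trans (cong (_% n) (trans (+-assoc m i _) (cong (m +_) (m+[n∸m]≡n i≤j)))) (sym eq))

  mod-cycSucc : ∀ j → CycSucc (j mod n) (suc j mod n)
  mod-cycSucc j with suc (j % n) <? n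
  ... | yes 1+j%n<n = inj₁ (begin
    suc (toℕ (j mod n))   ≡⟨ cong suc (toℕ-mod j) ⟩
    suc (j % n)           ≡⟨ sym (m<n⇒m%n≡m 1+j%n<n) ⟩
    suc (j % n) % n       ≡⟨ [o+m%n]%n≡[o+m]%n 1 j ⟩
    suc j % n             ≡⟨ sym (toℕ-mod (suc j)) ⟩
    toℕ (suc j mod n)     ∎)
    where open ≡-Reasoning
  ... | no 1+j%n≮n = inj₂ (trans (cong suc (toℕ-mod j)) 1+j%n≡n , (begin
    toℕ (suc j mod n)     ≡⟨ toℕ-mod (suc j) ⟩
    suc j % n             ≡⟨ sym ([o+m%n]%n≡[o+m]%n 1 j) ⟩
    suc (j % n) % n       ≡⟨ cong (_% n) 1+j%n≡n ⟩
    n % n                 ≡⟨ n%n≡0 n ⟩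
    0                     ∎))
    where
    open ≡-Reasoning
    1+j%n≡n : suc (j % n) ≡ n
    1+j%n≡n = ≤-antisym (m%n<n j n) (≮⇒≥ 1+j%n≮n)

module Periodic {N : ℕ} .{{_ : NonZero N}} {U : List ℚ} {w : Fin N → ℚ}
                (w-escher : Escher U N w) where

  W : ℕ → ℚ
  W j = w (j mod N)

  W-periodic : ∀ {i j} → i ≡ j + N → W i ≡ W j
  W-periodic {i} {j} i≡j+N = cong w (toℕ-injective (begin
    toℕ (i mod N)   ≡⟨ toℕ-mod i ⟩
    i % N           ≡⟨ cong (_% N) i≡j+N ⟩
    (j + N) % N     ≡⟨ [m+n]%n≡m%n j N ⟩
    j % N           ≡⟨ sym (toℕ-mod j) ⟩
    toℕ (j mod N)   ∎))
    where open ≡-Reasoning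

  W-step : ∀ {i j} → suc i ≡ j → W i ⟶ W j
  W-step {i} refl = proj₂ (proj₂ w-escher) (i mod N) (suc i mod N) (mod-cycSucc i)

  window-escher : ∀ c {p} → suc p ≤ N → W (c + p) ⟶ W c →
                  Escher U (suc p) (λ i → W (c + toℕ i))
  window-escher c {p} 1+p≤N closes =
    (λ i → proj₁ w-escher ((c + toℕ i) mod N)) , injective , arrows
    where
    injective : ∀ {i j} → W (c + toℕ i) ≡ W (c + toℕ j) → i ≡ j
    injective {i} {j} eq = toℕ-injective ([m+i]%n-injective c
      (<-≤-trans (toℕ<n i) 1+p≤N) (<-≤-trans (toℕ<n j) 1+p≤N) (begin
        (c + toℕ i) % N         ≡⟨ sym (toℕ-mod (c + toℕ i)) ⟩
        toℕ ((c + toℕ i) mod N) ≡⟨ cong toℕ (proj₁ (proj₂ w-escher) eq) ⟩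
        toℕ ((c + toℕ j) mod N) ≡⟨ toℕ-mod (c + toℕ j) ⟩
        (c + toℕ j) % N         ∎))
      where open ≡-Reasoning
    arrows : ∀ i j → CycSucc i j → W (c + toℕ i) ⟶ W (c + toℕ j)
    arrows i j (inj₁ 1+i≡j) = W-step (trans (sym (+-suc c (toℕ i))) (cong (c +_) 1+i≡j))
    arrows i j (inj₂ (1+i≡1+p , j≡0)) =
      subst₂ (λ i j → W (c + i) ⟶ W (c + j)) (sym (suc-injective 1+i≡1+p)) (sym j≡0)
        (subst (W (c + p) ⟶_) (cong W (sym (+-identityʳ c))) closes)

lemma4p3 : (n k : ℕ) → 1 ≤ n → 1 ≤ k →
    (U : List ℚ) → Unique U → length U ≡ n + k →
    (w : Fin (n + k) → ℚ) → Escher U (n + k) w →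
    (m : ℕ) →
    at (n + k) w (m + 1) ≺ at (n + k) w (m + k) →
    at (n + k) w m ⟶ at (n + k) w (m + k + 1) →
    Escher U n (λ i → at (n + k) w (m + k + toℕ i)) ×
    Escher U n (λ i → at (n + k) w (m + k + 1 + toℕ i)) ×
    Escher U n (λ i → at (n + k) w (m + k + 2 + toℕ i))
-- Since n + k reduces to suc (n' + k), at (n + k) w is definitionally Periodic.W.
lemma4p3 (suc n') k _ _ U _ _ w w-escher m m+1≺m+k m⟶m+k+1 =
  window-escher (m + k) n≤N closes₀ ,
  window-escher (m + k + 1) n≤N closes₁ ,
  window-escher (m + k + 2) n≤N closes₂
  where
  open Periodic w-escher
  n≤N : suc n' ≤ suc n' + k
  n≤N = m≤m+n (suc n') k
  wraps₀ : suc (m + k + n') ≡ m + (suc n' + k)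
  wraps₀ = solve (m ∷ k ∷ n' ∷ [])
  wraps₁ : m + k + 1 + n' ≡ m + (suc n' + k)
  wraps₁ = solve (m ∷ k ∷ n' ∷ [])
  wraps₂ : m + k + 2 + n' ≡ (m + 1) + (suc n' + k)
  wraps₂ = solve (m ∷ k ∷ n' ∷ [])
  closes₀ : W (m + k + n') ⟶ W (m + k)
  closes₀ = ⟶-⟶-≺⇒⟶ {c = W (m + 1)}
    (subst (W (m + k + n') ⟶_) (W-periodic wraps₀) (W-step refl))
    (W-step (+-comm 1 m))
    m+1≺m+k
  closes₁ : W (m + k + 1 + n') ⟶ W (m + k + 1)
  closes₁ = subst (_⟶ W (m + k + 1)) (sym (W-periodic wraps₁)) m⟶m+k+1
  closes₂ : W (m + k + 2 + n') ⟶ W (m + k + 2)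
  closes₂ = subst (_⟶ W (m + k + 2)) (sym (W-periodic wraps₂))
    (≺-⟶-⟶⇒⟶ {c = W (m + k + 1)} {d = W (m + k + 2)}
      m+1≺m+k
      (W-step (+-comm 1 (m + k)))
      (W-step (sym (+-suc (m + k) 1))))
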